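{- Let $I$ be an input with no duplicate elements, and let $r_1$ and $r_2$ be the two possible initial maximal increasing and maximal decreasing runs on $I$ (buffer size $M$). Then $|r_1|<3M$ or $|r_2|<3M$.
   Context: Up-down run generation problem: an input stream of elements from a totally ordered set is presented in order to an algorithm with a buffer of $M$ slots; the algorithm reads elements in order into the buffer (initially the first $M$ elements) and writes elements from the buffer to an output sequence, each write freeing a slot that is filled by the next input element. A maximal increasing run is written by starting with the smallest buffered element, always writing the smallest buffered element larger than the last element written, and ending only when every buffered element is smaller than the last written; a maximal decreasing run is symmetric. $|r|$ denotes the number of elements in run $r$. -}

module Defs where

open import Level using (Level)
open import Data.Nat using (ℕ; zero; suc; _+_)
open import Data.List using (List; []; _∷_; take; drop; length)
open import Data.Maybe using (Maybe; just; nothing)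
open import Data.Product using (_×_; _,_)
open import Relation.Binary.Bundles using (StrictTotalOrder)
open import Relation.Binary.Definitions using (tri<; tri≈; tri>)

module _ {a ℓ₁ ℓ₂ : Level} (O : StrictTotalOrder a ℓ₁ ℓ₂) where
  open StrictTotalOrder O renaming (Carrier to A)

  -- smallest buffered element strictly larger than the last written one
  -- (nothing as bound = no constraint: the first element of a run)
  minAbove : Maybe A → List A → Maybe A
  minAbove b [] = nothing
  minAbove b (x ∷ xs) = pick (ok b) (minAbove b xs)
    where
    ok : Maybe A → Maybe A
    ok nothing = just x
    ok (just c) with compare c x
    ... | tri< _ _ _ = just x
    ... | tri≈ _ _ _ = nothing
    ... | tri> _ _ _ = nothing
    pick : Maybe A → Maybe A → Maybe A
    pick nothing m = m
    pick (just y) nothing = just y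
    pick (just y) (just z) with compare y z
    ... | tri< _ _ _ = just y
    ... | tri≈ _ _ _ = just y
    ... | tri> _ _ _ = just z

  maxBelow : Maybe A → List A → Maybe A
  maxBelow b [] = nothing
  maxBelow b (x ∷ xs) = pick (ok b) (maxBelow b xs)
    where
    ok : Maybe A → Maybe A
    ok nothing = just x
    ok (just c) with compare x c
    ... | tri< _ _ _ = just x
    ... | tri≈ _ _ _ = nothing
    ... | tri> _ _ _ = nothing
    pick : Maybe A → Maybe A → Maybe A
    pick nothing m = m
    pick (just y) nothing = just y
    pick (just y) (just z) with compare y z
    ... | tri< _ _ _ = just z
    ... | tri≈ _ _ _ = just y
    ... | tri> _ _ _ = just y

  remove : A → List A → List A
  remove x [] = []
  remove x (y ∷ ys) with compare x y
  ... | tri< _ _ _ = y ∷ remove x ys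
  ... | tri≈ _ _ _ = ys
  ... | tri> _ _ _ = y ∷ remove x ys

  -- after a write, the freed slot is filled by the next input element (if any)
  refill : List A → List A → List A × List A
  refill buf [] = buf , []
  refill buf (y ∷ ys) = (y ∷ buf) , ys

  -- The fuel argument bounds the number of writes (each write consumes one element).
  runLength : ℕ → (Maybe A → List A → Maybe A) → Maybe A → List A → List A → ℕ
  runLength zero next last buf inp = 0
  runLength (suc f) next last buf inp with next last buf
  ... | nothing = 0
  ... | just x with refill (remove x buf) inp
  ...   | buf' , inp' = suc (runLength f next (just x) buf' inp')

  initialRun : (Maybe A → List A → Maybe A) → ℕ → List A → ℕ
  initialRun next M I = runLength (length I) next nothing (take M I) (drop M I)

  incRunLength : ℕ → List A → ℕ
  incRunLength = initialRun minAbove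

  decRunLength : ℕ → List A → ℕ
  decRunLength = initialRun maxBelow

-- With a buffer of M slots, the first t + 1 elements written by a run were all read
-- among the first M + t input elements. Suppose x is written at position a of the
-- increasing run and at position b ≥ a of the decreasing run. The first a + 1 elements
-- of the increasing run are ≤ x and the first a elements of the decreasing run are > x:
-- 2a + 1 distinct elements read among the first M + a, so a < M and x is among the first
-- 2M − 1 inputs. Reversing the order gives the case b ≤ a. If both runs had length ≥ 3M,
-- their first 3M elements would share at most 2M − 1 values, so they would contain
-- 6M − (2M − 1) = 4M + 1 distinct elements read among the first 4M − 1 inputs.
module Submission where

open import Defs
open import Level using (Level)
open import Function using (_∘_; id; flip)
open import Data.Empty using (⊥; ⊥-elim)
open import Data.Unit.Polymorphic using (⊤; tt)
open import Data.Maybe using (Maybe; just; nothing)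
open import Data.Maybe.Properties using (just-injective)
open import Data.Product using (_×_; _,_; proj₁; proj₂; uncurry)
open import Data.Sum using (_⊎_; inj₁; inj₂; [_,_]′)
open import Data.Bool using (true; false)
open import Data.Nat using (ℕ; zero; suc; _+_; _*_; _≤_; _<_; z≤n; s≤s; s≤s⁻¹; _<?_)
open import Data.Nat.Properties
  using (≤-trans; ≤-reflexive; ≤-total; n≤1+n; m≤m+n; +-suc; +-cancelʳ-≤; +-mono-≤; +-monoʳ-≤;
         +-commutativeSemigroup; m≤n⇒m⊓n≡m; m⊓n≤m; <-irrefl; ≮⇒≥; module ≤-Reasoning)
open import Data.Nat.Tactic.RingSolver using (solve-∀)
open import Algebra.Properties.CommutativeSemigroup +-commutativeSemigroup using (x∙yz≈y∙xz)
open import Data.List using (List; []; _∷_; _++_; _∷ʳ_; take; drop; length; filter)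
open import Data.List.Properties using (length-++; length-take; length-++-≤ˡ)
open import Data.List.Relation.Unary.All as All using (All; []; _∷_)
import Data.List.Relation.Unary.All.Properties as All
open import Data.List.Relation.Unary.AllPairs as AllPairs using (AllPairs; []; _∷_)
import Data.List.Relation.Unary.AllPairs.Properties as AllPairs
open import Data.List.Relation.Unary.Any using (here; there)
import Data.List.Membership.Propositional as Propositional
open import Data.List.Membership.Propositional.Properties using (∈-∃++)
import Data.List.Membership.Setoid.Properties as ∈ₛ
open import Data.List.Relation.Unary.Unique.Setoid using (Unique)
import Data.List.Relation.Unary.Unique.Setoid.Properties as Unique
import Data.List.Fresh as List#
import Data.List.Fresh.Relation.Unary.Any as Any#
open import Data.List.Fresh.Membership.Setoid.Properties using (injection)
import Data.List.Relation.Binary.Sublist.Setoid.Properties as Sublist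
open import Data.List.Relation.Binary.Subset.Setoid.Properties using (Sublist⇒Subset; filter-⊆)
open import Relation.Nullary using (¬_; yes; no; does)
open import Relation.Unary using (Pred; Decidable)
open import Relation.Unary.Properties using (∁?)
open import Relation.Binary.Core using (Rel)
open import Relation.Binary.Bundles using (Setoid; StrictPartialOrder; StrictTotalOrder)
open import Relation.Binary.Definitions using (Transitive; tri<; tri≈; tri>)
import Relation.Binary.Construct.Flip.EqAndOrd as Flip
open import Relation.Binary.PropositionalEquality
  using (_≡_; refl; sym; trans; cong; cong₂; subst; subst₂)

module _ {a} {A : Set a} where

  take-suc-length : ∀ xs (y : A) ys → take (suc (length xs)) (xs ++ y ∷ ys) ≡ xs ∷ʳ y
  take-suc-length []       y ys = refl
  take-suc-length (x ∷ xs) y ys = cong (x ∷_) (take-suc-length xs y ys)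

  take-++ˡ : ∀ n (xs : List A) {ys} → n ≤ length xs → take n (xs ++ ys) ≡ take n xs
  take-++ˡ zero    xs       _         = refl
  take-++ˡ (suc n) (x ∷ xs) (s≤s n≤) = cong (x ∷_) (take-++ˡ n xs n≤)

  length-take-≡ : ∀ {n} (xs : List A) → n ≤ length xs → length (take n xs) ≡ n
  length-take-≡ {n} xs n≤ = trans (length-take n xs) (m≤n⇒m⊓n≡m n≤)

  length-take-≤ : ∀ n (xs : List A) → length (take n xs) ≤ n
  length-take-≤ n xs = ≤-trans (≤-reflexive (length-take n xs)) (m⊓n≤m n _)

  length-∷ʳ : ∀ (xs : List A) {y} → length (xs ∷ʳ y) ≡ suc (length xs)
  length-∷ʳ []       = refl
  length-∷ʳ (x ∷ xs) = cong suc (length-∷ʳ xs)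

  drop-suc : ∀ k (xs : List A) → drop 1 (drop k xs) ≡ drop (suc k) xs
  drop-suc zero    xs       = refl
  drop-suc (suc k) []       = refl
  drop-suc (suc k) (x ∷ xs) = drop-suc k xs

  length-filter-∁ : ∀ {p} {P : Pred A p} (P? : Decidable P) xs →
                    length (filter P? xs) + length (filter (∁? P?) xs) ≡ length xs
  length-filter-∁ P? []       = refl
  length-filter-∁ P? (x ∷ xs) with does (P? x)
  ... | true  = cong suc (length-filter-∁ P? xs)
  ... | false = trans (+-suc _ _) (cong suc (length-filter-∁ P? xs))

  sorted-before : ∀ {r} {R : Rel A r} xs {y ys} →
                  AllPairs R (xs ++ y ∷ ys) → All (λ u → R u y) xs
  sorted-before []       _          = []
  sorted-before (x ∷ xs) (Rx ∷ Rxs) = All.head (All.++⁻ʳ xs Rx) ∷ sorted-before xs Rxs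

module Pigeonhole {c ℓ} (S : Setoid c ℓ) where
  open Setoid S using () renaming (Carrier to A)
  open import Data.List.Membership.Setoid S using (_∈_)
  open import Data.List.Relation.Binary.Subset.Setoid S using (_⊆_)
  open import Data.List.Relation.Binary.Disjoint.Setoid S using (Disjoint)
  open import Data.List.Fresh.Membership.Setoid S using () renaming (_∈_ to _∈#_)

  private variable
    x : A
    xs ys zs : List A

  -- `Unique S` lists are fresh lists for _≉_, whose pigeonhole principle is `injection`.
  length-fromList : (xs! : Unique S xs) → List#.length (List#.fromList xs!) ≡ length xs
  length-fromList []        = refl
  length-fromList (_ ∷ xs!) = cong suc (length-fromList xs!)

  ∈-fromList⁺ : (xs! : Unique S xs) → x ∈ xs → x ∈# List#.fromList xs!
  ∈-fromList⁺ (_ ∷ _)   (here x≈y) = Any#.here x≈y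
  ∈-fromList⁺ (_ ∷ xs!) (there x∈) = Any#.there (∈-fromList⁺ xs! x∈)

  ∈-fromList⁻ : (xs! : Unique S xs) → x ∈# List#.fromList xs! → x ∈ xs
  ∈-fromList⁻ (_ ∷ _)   (Any#.here x≈y) = here x≈y
  ∈-fromList⁻ (_ ∷ xs!) (Any#.there x∈) = there (∈-fromList⁻ xs! x∈)

  unique-length-≤ : Unique S xs → Unique S ys → xs ⊆ ys → length xs ≤ length ys
  unique-length-≤ xs! ys! xs⊆ys =
    subst₂ _≤_ (length-fromList xs!) (length-fromList ys!)
      (injection S id (∈-fromList⁺ ys! ∘ xs⊆ys ∘ ∈-fromList⁻ xs!))

  disjoint-length-≤ : Unique S xs → Unique S ys → Disjoint xs ys → Unique S zs →
                      xs ++ ys ⊆ zs → length xs + length ys ≤ length zs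
  disjoint-length-≤ {xs} xs! ys! xs#ys zs! ⊆zs =
    subst (_≤ _) (length-++ xs) (unique-length-≤ (Unique.++⁺ S xs! ys! xs#ys) zs! ⊆zs)

module Prefixes {c ℓ} (S : Setoid c ℓ) where
  open Setoid S using () renaming (Carrier to A; refl to ≈-refl; sym to ≈-sym)
  open import Data.List.Membership.Setoid S using (_∈_)
  open import Data.List.Relation.Binary.Subset.Setoid S using (_⊆_)

  private variable
    x : A
    xs ys zs I : List A
    m n k : ℕ

  take-⊆ : ∀ n xs → take n xs ⊆ xs
  take-⊆ n xs = Sublist⇒Subset S (Sublist.take-⊆ S n xs)

  take-mono : m ≤ n → take m xs ⊆ take n xs
  take-mono m≤n = Sublist⇒Subset S (Sublist.take⁺ S m≤n)

  ∈-take-suc : ∀ k xs {y ys} → y ∷ ys ≡ drop k xs → y ∈ take (suc k) xs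
  ∈-take-suc zero    (x ∷ xs) refl = here ≈-refl
  ∈-take-suc (suc k) (x ∷ xs) eq   = there (∈-take-suc k xs eq)

  ++-⊆ : xs ⊆ zs → ys ⊆ zs → xs ++ ys ⊆ zs
  ++-⊆ {xs} xs⊆ ys⊆ = [ xs⊆ , ys⊆ ]′ ∘ ∈ₛ.∈-++⁻ S xs

  Lagging : ℕ → List A → List A → Set _
  Lagging k I ws = ∀ t → take (suc t) ws ⊆ take (k + t) I

  lagging-∷ : ∀ {ws} → x ∈ take k I → Lagging (suc k) I ws → Lagging k I (x ∷ ws)
  lagging-∷ {k = k} x∈ lag t       (here v≈x) =
    take-mono (m≤m+n k t) (∈ₛ.∈-resp-≈ S (≈-sym v≈x) x∈)
  lagging-∷ {k = k} x∈ lag (suc t) (there v∈) =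
    take-mono (≤-reflexive (sym (+-suc k t))) (lag t v∈)

module Runs {a ℓ₁ ℓ₂} (O : StrictTotalOrder a ℓ₁ ℓ₂) where
  open StrictTotalOrder O using (module Eq; compare) renaming (Carrier to A; _<_ to _≺_; _>_ to _≻_)
  open Prefixes Eq.setoid
  open import Data.List.Membership.Setoid Eq.setoid using (_∈_)
  open import Data.List.Relation.Binary.Subset.Setoid Eq.setoid using (_⊆_)

  Selector : Set a
  Selector = Maybe A → List A → Maybe A

  Bounded : Rel A ℓ₂ → Maybe A → A → Set ℓ₂
  Bounded R nothing  x = ⊤
  Bounded R (just c) x = R c x

  HeadOrTail : Rel A ℓ₂ → Selector → Set _
  HeadOrTail R next = ∀ b y ys {x} → next b (y ∷ ys) ≡ just x →
                      (y ≡ x × Bounded R b y) ⊎ next b ys ≡ just x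

  Selects : Rel A ℓ₂ → Selector → Set _
  Selects R next = ∀ b buf {x} → next b buf ≡ just x → x ∈ buf × Bounded R b x

  selects : ∀ {R next} → (∀ b → next b [] ≡ nothing) → HeadOrTail R next → Selects R next
  selects empty head-or-tail b []       eq with () ← trans (sym (empty b)) eq
  selects empty head-or-tail b (y ∷ ys) eq with head-or-tail b y ys eq
  ... | inj₁ (refl , bounded) = here Eq.refl , bounded
  ... | inj₂ eq′              =
    let x∈ys , bounded = selects empty head-or-tail b ys eq′ in there x∈ys , bounded

  -- The case splits replay those of the local helpers `ok` and `pick` of `minAbove`
  -- and `maxBelow`, which cannot be referred to by name.
  minAbove-∷ : HeadOrTail _≺_ (minAbove O)
  minAbove-∷ nothing y ys eq with minAbove O nothing ys
  ... | nothing = inj₁ (just-injective eq , tt)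
  ... | just z with compare y z
  ...   | tri< _ _ _ = inj₁ (just-injective eq , tt)
  ...   | tri≈ _ _ _ = inj₁ (just-injective eq , tt)
  ...   | tri> _ _ _ = inj₂ eq
  minAbove-∷ (just c) y ys eq with compare c y
  ... | tri≈ _ _ _ = inj₂ eq
  ... | tri> _ _ _ = inj₂ eq
  ... | tri< c≺y _ _ with minAbove O (just c) ys
  ...   | nothing = inj₁ (just-injective eq , c≺y)
  ...   | just z with compare y z
  ...     | tri< _ _ _ = inj₁ (just-injective eq , c≺y)
  ...     | tri≈ _ _ _ = inj₁ (just-injective eq , c≺y)
  ...     | tri> _ _ _ = inj₂ eq

  maxBelow-∷ : HeadOrTail _≻_ (maxBelow O)
  maxBelow-∷ nothing y ys eq with maxBelow O nothing ys
  ... | nothing = inj₁ (just-injective eq , tt)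
  ... | just z with compare y z
  ...   | tri< _ _ _ = inj₂ eq
  ...   | tri≈ _ _ _ = inj₁ (just-injective eq , tt)
  ...   | tri> _ _ _ = inj₁ (just-injective eq , tt)
  maxBelow-∷ (just c) y ys eq with compare y c
  ... | tri≈ _ _ _ = inj₂ eq
  ... | tri> _ _ _ = inj₂ eq
  ... | tri< y≺c _ _ with maxBelow O (just c) ys
  ...   | nothing = inj₁ (just-injective eq , y≺c)
  ...   | just z with compare y z
  ...     | tri< _ _ _ = inj₂ eq
  ...     | tri≈ _ _ _ = inj₁ (just-injective eq , y≺c)
  ...     | tri> _ _ _ = inj₁ (just-injective eq , y≺c)

  minAbove-selects : Selects _≺_ (minAbove O)
  minAbove-selects = selects (λ _ → refl) minAbove-∷

  maxBelow-selects : Selects _≻_ (maxBelow O)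
  maxBelow-selects = selects (λ _ → refl) maxBelow-∷

  remove-⊆ : ∀ x buf → remove O x buf ⊆ buf
  remove-⊆ x []       ()
  remove-⊆ x (y ∷ ys) v∈ with compare x y
  ... | tri≈ _ _ _ = there v∈
  remove-⊆ x (y ∷ ys) (here v≈y) | tri< _ _ _ = here v≈y
  remove-⊆ x (y ∷ ys) (there v∈) | tri< _ _ _ = there (remove-⊆ x ys v∈)
  remove-⊆ x (y ∷ ys) (here v≈y) | tri> _ _ _ = here v≈y
  remove-⊆ x (y ∷ ys) (there v∈) | tri> _ _ _ = there (remove-⊆ x ys v∈)

  run : ℕ → Selector → Maybe A → List A → List A → List A
  run zero    next last buf inp = []
  run (suc f) next last buf inp with next last buf
  ... | nothing = []
  ... | just x  = x ∷ uncurry (run f next (just x)) (refill O (remove O x buf) inp)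

  length-run : ∀ f next last buf inp →
               length (run f next last buf inp) ≡ runLength O f next last buf inp
  length-run zero    next last buf inp = refl
  length-run (suc f) next last buf inp with next last buf
  ... | nothing = refl
  ... | just x with refill O (remove O x buf) inp
  ...   | buf′ , inp′ = cong suc (length-run f next (just x) buf′ inp′)

  module _ {R : Rel A ℓ₂} (R-trans : Transitive R) {next : Selector} (sel : Selects R next) where

    bounded-trans : ∀ b {x y} → Bounded R b x → R x y → Bounded R b y
    bounded-trans nothing  _   _   = tt
    bounded-trans (just c) Rcx Rxy = R-trans Rcx Rxy

    run-bounded : ∀ f last buf inp → All (Bounded R last) (run f next last buf inp)
    run-bounded zero    last buf inp = []
    run-bounded (suc f) last buf inp with next last buf | sel last buf
    ... | nothing | _     = []
    ... | just x  | sel-x =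
      let bounded-x = proj₂ (sel-x refl)
      in bounded-x ∷ All.map (bounded-trans last bounded-x) (run-bounded f (just x) _ _)

    run-sorted : ∀ f last buf inp → AllPairs R (run f next last buf inp)
    run-sorted zero    last buf inp = []
    run-sorted (suc f) last buf inp with next last buf
    ... | nothing = []
    ... | just x  = run-bounded f (just x) _ _ ∷ run-sorted f (just x) _ _

  Reads : ℕ → List A → List A × List A → Set _
  Reads k I (buf , inp) = buf ⊆ take k I × inp ≡ drop k I

  refill-reads : ∀ {k I buf} inp → Reads k I (buf , inp) → Reads (suc k) I (refill O buf inp)
  refill-reads {k} {I} [] (buf⊆ , inp≡) =
    take-mono (n≤1+n k) ∘ buf⊆ , trans (cong (drop 1) inp≡) (drop-suc k I)
  refill-reads {k} {I} (y ∷ ys) (buf⊆ , inp≡) =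
    y∷buf⊆ , trans (cong (drop 1) inp≡) (drop-suc k I)
    where
    y∷buf⊆ : y ∷ _ ⊆ take (suc k) I
    y∷buf⊆ (here v≈y) = ∈ₛ.∈-resp-≈ Eq.setoid (Eq.sym v≈y) (∈-take-suc k I inp≡)
    y∷buf⊆ (there v∈) = take-mono (n≤1+n k) (buf⊆ v∈)

  run-lagging : ∀ {R next} → Selects R next → ∀ {k I} f last buf inp →
                Reads k I (buf , inp) → Lagging k I (run f next last buf inp)
  run-lagging sel zero last buf inp _ t ()
  run-lagging {next = next} sel (suc f) last buf inp (buf⊆ , inp≡) with next last buf | sel last buf
  ... | nothing | _     = λ t ()
  ... | just x  | sel-x =
    lagging-∷ (buf⊆ (proj₁ (sel-x refl)))
      (run-lagging sel f (just x) _ _ (refill-reads inp (buf⊆ ∘ remove-⊆ x buf , inp≡)))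

  initialOutput : Selector → ℕ → List A → List A
  initialOutput next M I = run (length I) next nothing (take M I) (drop M I)

  length-initialOutput : ∀ next M I → length (initialOutput next M I) ≡ initialRun O next M I
  length-initialOutput next M I = length-run (length I) next nothing (take M I) (drop M I)

  initialOutput-sorted : ∀ {R next} → Transitive R → Selects R next →
                         ∀ M I → AllPairs R (initialOutput next M I)
  initialOutput-sorted R-trans sel M I = run-sorted R-trans sel (length I) nothing (take M I) (drop M I)

  initialOutput-lagging : ∀ {R next} → Selects R next →
                          ∀ M I → Lagging M I (initialOutput next M I)
  initialOutput-lagging sel M I = run-lagging sel (length I) nothing (take M I) (drop M I) (id , refl)

module Crossing {c ℓ₁ ℓ₂} (P : StrictPartialOrder c ℓ₁ ℓ₂) where
  open StrictPartialOrder P renaming (Carrier to A; _<_ to _≺_; _>_ to _≻_)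
  open Pigeonhole Eq.setoid
  open Prefixes Eq.setoid
  open import Data.List.Membership.Setoid Eq.setoid using (_∈_)
  open import Data.List.Relation.Binary.Subset.Setoid Eq.setoid using (_⊆_)
  open import Data.List.Relation.Binary.Disjoint.Setoid Eq.setoid using (Disjoint)
  open ≤-Reasoning

  ≺-unique : ∀ {xs} → AllPairs _≺_ xs → Unique Eq.setoid xs
  ≺-unique = AllPairs.map (λ x≺y x≈y → irrefl x≈y x≺y)

  ≻-unique : ∀ {xs} → AllPairs _≻_ xs → Unique Eq.setoid xs
  ≻-unique = AllPairs.map (λ y≺x x≈y → irrefl (Eq.sym x≈y) y≺x)

  common-read-early-≤ : ∀ {I} → Unique Eq.setoid I → ∀ m pre {x post} preV {y postV} →
    AllPairs _≺_ (pre ++ x ∷ post) → Lagging (suc m) I (pre ++ x ∷ post) →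
    AllPairs _≻_ (preV ++ y ∷ postV) → Lagging (suc m) I (preV ++ y ∷ postV) →
    x ≈ y → length pre ≤ length preV → x ∈ take (suc m + m) I
  common-read-early-≤ {I} I! m pre {x} {post} preV {y} {postV} ws≺ ws-lag vs≻ vs-lag x≈y a≤b =
    take-mono (+-monoʳ-≤ (suc m) a≤m) (L₁⊆ (∈ₛ.∈-++⁺ʳ Eq.setoid pre (here Eq.refl)))
    where
    a = length pre
    vs = preV ++ y ∷ postV
    L₁ = pre ∷ʳ x
    L₂ = take a vs
    L₁⊆ : L₁ ⊆ take (suc m + a) I
    L₁⊆ = subst (_⊆ take (suc m + a) I) (take-suc-length pre x post) (ws-lag a)
    L₂⊆ : L₂ ⊆ take (suc m + a) I
    L₂⊆ = vs-lag a ∘ take-mono (n≤1+n a)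
    L₁! : Unique Eq.setoid L₁
    L₁! = ≺-unique
      (subst (AllPairs _≺_) (take-suc-length pre x post) (AllPairs.take⁺ (suc a) ws≺))
    L₂! : Unique Eq.setoid L₂
    L₂! = ≻-unique (AllPairs.take⁺ a vs≻)
    L₁≼x : All (λ u → ¬ x ≺ u) L₁
    L₁≼x = All.++⁺ (All.map (λ u≺x x≺u → asym u≺x x≺u) (sorted-before pre ws≺))
                   (irrefl Eq.refl ∷ [])
    x≺L₂ : All (x ≺_) L₂
    x≺L₂ = subst (All (x ≺_)) (sym (take-++ˡ a preV a≤b))
           (All.take⁺ a (All.map (<-respˡ-≈ (Eq.sym x≈y)) (sorted-before preV vs≻)))
    L₁#L₂ : Disjoint L₁ L₂
    L₁#L₂ (v∈L₁ , v∈L₂) =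
      All.lookupₛ Eq.setoid (λ u≈w x⊀u x≺w → x⊀u (<-respʳ-≈ (Eq.sym u≈w) x≺w)) L₁≼x v∈L₁
        (All.lookupₛ Eq.setoid <-respʳ-≈ x≺L₂ v∈L₂)
    2a+1≤M+a : suc a + a ≤ suc m + a
    2a+1≤M+a = begin
      suc a + a
        ≡⟨ cong₂ _+_ (length-∷ʳ pre) (length-take-≡ vs (≤-trans a≤b (length-++-≤ˡ preV))) ⟨
      length L₁ + length L₂
        ≤⟨ disjoint-length-≤ L₁! L₂! L₁#L₂ (Unique.take⁺ Eq.setoid _ I!) (++-⊆ L₁⊆ L₂⊆) ⟩
      length (take (suc m + a) I)
        ≤⟨ length-take-≤ (suc m + a) I ⟩
      suc m + a
        ∎
    a≤m : a ≤ m
    a≤m = s≤s⁻¹ (+-cancelʳ-≤ a (suc a) (suc m) 2a+1≤M+a)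

module Counting {a ℓ₁ ℓ₂} (O : StrictTotalOrder a ℓ₁ ℓ₂) where
  open StrictTotalOrder O using (module Eq; strictPartialOrder) renaming (_<_ to _≺_; _>_ to _≻_)
  open Pigeonhole Eq.setoid
  open Prefixes Eq.setoid
  open import Data.List.Membership.Setoid Eq.setoid using (_∈_)
  open import Data.List.Membership.DecSetoid Eq.decSetoid using (_∈?_)
  open import Data.List.Relation.Binary.Subset.Setoid Eq.setoid using (_⊆_)
  open import Data.List.Relation.Binary.Disjoint.Setoid Eq.setoid using (Disjoint)
  module ≺ = Crossing strictPartialOrder
  module ≻ = Crossing (Flip.strictPartialOrder strictPartialOrder)

  6m+4<6m+6 : ∀ m → (suc m + m) + (suc m + (m + 2 * suc m)) < 3 * suc m + 3 * suc m
  6m+4<6m+6 m = ≤-trans (n≤1+n _) (≤-reflexive (count m))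
    where
    count : ∀ m → 2 + ((suc m + m) + (suc m + (m + 2 * suc m))) ≡ 3 * suc m + 3 * suc m
    count = solve-∀

  module _ {I} (I! : Unique Eq.setoid I) (m : ℕ) where

    common-read-early : ∀ {ws vs v} → AllPairs _≺_ ws → AllPairs _≻_ vs →
      Lagging (suc m) I ws → Lagging (suc m) I vs → v ∈ ws → v ∈ vs → v ∈ take (suc m + m) I
    common-read-early ws≺ vs≻ ws-lag vs-lag v∈ws v∈vs
      with Propositional.find v∈ws | Propositional.find v∈vs
    ... | x , x∈ws , v≈x | y , y∈vs , v≈y with ∈-∃++ x∈ws | ∈-∃++ y∈vs
    ... | pre , post , refl | preV , postV , refl with ≤-total (length pre) (length preV)
    ... | inj₁ a≤b = ∈ₛ.∈-resp-≈ Eq.setoid (Eq.sym v≈x)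
          (≺.common-read-early-≤ I! m pre preV ws≺ ws-lag vs≻ vs-lag (Eq.trans (Eq.sym v≈x) v≈y) a≤b)
    ... | inj₂ b≤a = ∈ₛ.∈-resp-≈ Eq.setoid (Eq.sym v≈y)
          (≻.common-read-early-≤ I! m preV pre vs≻ vs-lag ws≺ ws-lag (Eq.trans (Eq.sym v≈y) v≈x) b≤a)

    not-both-long : ∀ {ws vs} → AllPairs _≺_ ws → AllPairs _≻_ vs →
      Lagging (suc m) I ws → Lagging (suc m) I vs →
      3 * suc m ≤ length ws → 3 * suc m ≤ length vs → ⊥
    not-both-long {ws} {vs} ws≺ vs≻ ws-lag vs-lag N≤ws N≤vs = <-irrefl refl (begin-strict
      N + N                                 ≡⟨ cong₂ _+_ (length-take-≡ ws N≤ws) (length-take-≡ vs N≤vs) ⟨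
      length W + length V                   ≡⟨ cong (length W +_) (length-filter-∁ (_∈? Q) V) ⟨
      length W + (length Vin + length Vout) ≡⟨ x∙yz≈y∙xz (length W) (length Vin) (length Vout) ⟩
      length Vin + (length W + length Vout) ≤⟨ +-mono-≤ Vin≤ WVout≤ ⟩
      (suc m + m) + (suc m + t)             <⟨ 6m+4<6m+6 m ⟩
      N + N                                 ∎)
      where
      open ≤-Reasoning
      N = 3 * suc m
      t = m + 2 * suc m
      Q = take (suc m + m) I
      W = take N ws
      V = take N vs
      Vin = filter (_∈? Q) V
      Vout = filter (∁? (_∈? Q)) V
      W! : Unique Eq.setoid W
      W! = ≺.≺-unique (AllPairs.take⁺ N ws≺)
      V! : Unique Eq.setoid V
      V! = ≺.≻-unique (AllPairs.take⁺ N vs≻)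
      Vin⊆Q : Vin ⊆ Q
      Vin⊆Q = proj₂ ∘ ∈ₛ.∈-filter⁻ Eq.setoid (_∈? Q) (∈ₛ.∈-resp-≈ Eq.setoid) {xs = V}
      W#Vout : Disjoint W Vout
      W#Vout (v∈W , v∈Vout) =
        let v∈V , v∉Q = ∈ₛ.∈-filter⁻ Eq.setoid (∁? (_∈? Q)) (∈ₛ.∉-resp-≈ Eq.setoid) v∈Vout
        in v∉Q (common-read-early ws≺ vs≻ ws-lag vs-lag (take-⊆ N ws v∈W) (take-⊆ N vs v∈V))
      W++Vout⊆ : W ++ Vout ⊆ take (suc m + t) I
      W++Vout⊆ = ++-⊆ (ws-lag t) (vs-lag t ∘ filter-⊆ Eq.setoid (∁? (_∈? Q)) V)
      Vin≤ : length Vin ≤ suc m + m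
      Vin≤ = ≤-trans
        (unique-length-≤ (Unique.filter⁺ Eq.setoid (_∈? Q) V!) (Unique.take⁺ Eq.setoid _ I!) Vin⊆Q)
        (length-take-≤ _ I)
      WVout≤ : length W + length Vout ≤ suc m + t
      WVout≤ = ≤-trans
        (disjoint-length-≤ W! (Unique.filter⁺ Eq.setoid (∁? (_∈? Q)) V!) W#Vout
          (Unique.take⁺ Eq.setoid _ I!) W++Vout⊆)
        (length-take-≤ _ I)

    one-run-short : ∀ {ws vs} → AllPairs _≺_ ws → AllPairs _≻_ vs →
      Lagging (suc m) I ws → Lagging (suc m) I vs →
      length ws < 3 * suc m ⊎ length vs < 3 * suc m
    one-run-short {ws} {vs} ws≺ vs≻ ws-lag vs-lag
      with length ws <? 3 * suc m | length vs <? 3 * suc m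
    ... | yes ws<N | _        = inj₁ ws<N
    ... | no _     | yes vs<N = inj₂ vs<N
    ... | no ws≮N  | no vs≮N  =
      ⊥-elim (not-both-long ws≺ vs≻ ws-lag vs-lag (≮⇒≥ ws≮N) (≮⇒≥ vs≮N))

lemma5 : {a ℓ₁ ℓ₂ : Level} (O : StrictTotalOrder a ℓ₁ ℓ₂) (M : ℕ) (I : List (StrictTotalOrder.Carrier O)) →
    1 ≤ M →
    Unique (StrictTotalOrder.Eq.setoid O) I →
    incRunLength O M I < 3 * M ⊎ decRunLength O M I < 3 * M
lemma5 O (suc m) I (s≤s z≤n) I! =
  subst₂ (λ r₁ r₂ → r₁ < 3 * suc m ⊎ r₂ < 3 * suc m)
    (length-initialOutput (minAbove O) (suc m) I) (length-initialOutput (maxBelow O) (suc m) I)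
    (one-run-short I! m
      (initialOutput-sorted (StrictTotalOrder.trans O) minAbove-selects (suc m) I)
      (initialOutput-sorted (flip (StrictTotalOrder.trans O)) maxBelow-selects (suc m) I)
      (initialOutput-lagging minAbove-selects (suc m) I)
      (initialOutput-lagging maxBelow-selects (suc m) I))
  where
  open Runs O
  open Counting O
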